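{- Let $\phi$ be an $\mathcal{FL}^3$-sentence in normal form $\forall x_1 x_2 x_3\, \Omega \wedge \bigwedge_{i=1}^{s} \forall x_1 x_2 (\alpha_i \rightarrow \exists x_3\, \Gamma_i) \wedge \bigwedge_{j=1}^{t} \forall x_1 x_2 (\beta_j \rightarrow \forall x_3\, \delta_j)$ over a relational signature $\sigma$, with $s$ existential conjuncts. The following are equivalent: (i) $\phi$ is satisfiable; (ii) there exists a non-empty, globally coherent set $C$ of connector-types, each locally compatible with $\phi$, such that $|C|\le 2^{|\sigma|}$; (iii) $\phi$ is satisfiable over a domain of size at most $s\cdot 2^{2|\sigma|}$.
   Context: $\sigma$ is a purely relational signature without proposition letters (no constants, function symbols, equality). A fluted $k$-literal is $\pm p(x_\ell,\ldots,x_k)$ with $p\in\sigma$ of arity $k-\ell+1$, $1\le\ell\le k$; a fluted $k$-clause is a disjunction of fluted $k$-literals. In the normal form, $\Omega,\Gamma_i$ are sets (conjunctions) of fluted 3-clauses, $\alpha_i,\beta_j$ fluted 2-atoms, $\delta_j$ fluted 3-clauses. A fluted $k$-type is a maximal consistent set of fluted $k$-literals over $\sigma$. For a $k$-type $\tau$, $\tau^{[1]}$ increments all variable indices and $\tau_\uparrow$ removes literals containing $x_1$ and decrements indices. A connector-type is $\langle\pi,I,O\rangle$ with $\pi$ a 1-type, $I$ a set of fluted 2-types $\tau$ with $\tau_\uparrow=\pi$, $O$ a set of fluted 2-types. It is locally compatible with $\phi$ if (LC$\exists$) for every $i\le s$ and $\tau\in I$ with $\models\tau\rightarrow\alpha_i$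 there is $\tau'\in O$ with $\tau\wedge\tau'^{[1]}\wedge\Gamma_i\wedge\Omega\wedge\bigwedge_{j=1}^t(\beta_j\rightarrow\delta_j)$ consistent, and (LC$\forall$) for all $\tau\in I$, $\tau'\in O$, $\tau\wedge\tau'^{[1]}\wedge\Omega\wedge\bigwedge_{j=1}^t(\beta_j\rightarrow\delta_j)$ is consistent. A set $C$ of connector-types is globally coherent if (GC$\exists$) for all $\langle\pi,I,O\rangle\in C$ and $\tau\in O$ some $\langle\pi',I',O'\rangle\in C$ has $\tau\in I'$, and (GC$\forall$) for all $\langle\pi,I,O\rangle,\langle\pi',I',O'\rangle\in C$, $O\cap I'\neq\emptyset$. -}

module Defs where

open import Level using (Level) renaming (suc to lsuc; zero to lzero)
open import Data.Nat using (ℕ; zero; suc; _≤_; _<_; _*_; _^_; _≟_; z≤n; s≤s)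
open import Data.Nat.Properties using (≤-pred; ≤∧≢⇒<; m≤n⇒m≤1+n)
open import Data.Fin using (Fin)
open import Data.Bool using (Bool; true; false)
open import Data.Vec using (Vec; []; _∷_)
open import Data.List using (List; length; [])
open import Data.List.Relation.Unary.All using (All)
open import Data.List.Relation.Unary.Any using (Any)
open import Data.List.Membership.Propositional using (_∈_)
open import Data.Product using (Σ; _×_; _,_; proj₁)
open import Data.Sum using (_⊎_)
open import Relation.Nullary using (¬_; yes; no)
open import Relation.Binary.PropositionalEquality using (_≡_; refl)

-- A purely relational signature: m predicate symbols, each of arity ≥ 1
-- (no proposition letters, no constants, function symbols or equality).
-- |σ| = m.

record Sig : Set where
  field
    m      : ℕ
    ar     : Fin m → ℕ
    ar-pos : ∀ p → 1 ≤ ar p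
open Sig public

module _ (σ : Sig) where

  -- fluted k-atom p(x_ℓ,…,x_k) with ℓ = k - ar p + 1; determined by p
  -- together with the requirement ar p ≤ k.
  Atom : ℕ → Set
  Atom k = Σ (Fin (m σ)) λ p → ar σ p ≤ k

  -- fluted k-literal: sign (true = positive) and atom
  Lit : ℕ → Set
  Lit k = Bool × Atom k

  Clause : ℕ → Set
  Clause k = List (Lit k)

  Structure : Set → Set
  Structure D = (p : Fin (m σ)) → Vec D (ar σ p) → Bool

  lastN : {D : Set} {a k : ℕ} → a ≤ k → Vec D k → Vec D a
  lastN {a = a} {zero} z≤n [] = []
  lastN {a = a} {suc k} h (x ∷ xs) with a ≟ suc k
  ... | yes refl = x ∷ xs
  ... | no ne = lastN (≤-pred (≤∧≢⇒< h ne)) xs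

  holdsAtom : {D : Set} {k : ℕ} → Structure D → Atom k → Vec D k → Set
  holdsAtom M (p , h) xs = M p (lastN h xs) ≡ true

  holdsLit : {D : Set} {k : ℕ} → Structure D → Lit k → Vec D k → Set
  holdsLit M (b , (p , h)) xs = M p (lastN h xs) ≡ b

  holdsClause : {D : Set} {k : ℕ} → Structure D → Clause k → Vec D k → Set
  holdsClause M c xs = Any (λ l → holdsLit M l xs) c

  holdsClauses : {D : Set} {k : ℕ} → Structure D → List (Clause k) → Vec D k → Set
  holdsClauses M cs xs = All (λ c → holdsClause M c xs) cs

  record NF (s t : ℕ) : Set where
    field
      Ω : List (Clause 3)
      α : Fin s → Atom 2
      Γ : Fin s → List (Clause 3)
      β : Fin t → Atom 2
      δ : Fin t → Clause 3

  module _ {s t : ℕ} (φ : NF s t) where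
    open NF φ

    _⊨_ : {D : Set} → Structure D → Set
    _⊨_ {D} M =
        (∀ x₁ x₂ x₃ → holdsClauses M Ω (x₁ ∷ x₂ ∷ x₃ ∷ []))
      × (∀ i x₁ x₂ → holdsAtom M (α i) (x₁ ∷ x₂ ∷ [])
           → Σ D λ x₃ → holdsClauses M (Γ i) (x₁ ∷ x₂ ∷ x₃ ∷ []))
      × (∀ j x₁ x₂ → holdsAtom M (β j) (x₁ ∷ x₂ ∷ [])
           → ∀ x₃ → holdsClause M (δ j) (x₁ ∷ x₂ ∷ x₃ ∷ []))

  Satisfiable : {s t : ℕ} → NF s t → Set₁
  Satisfiable φ = Σ Set λ D → D × Σ (Structure D) λ M → _⊨_ φ M

  SatisfiableWithin : {s t : ℕ} → NF s t → ℕ → Set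
  SatisfiableWithin φ N =
    Σ ℕ λ n → 1 ≤ n × n ≤ N × Σ (Structure (Fin n)) λ M → _⊨_ φ M

  -- The atoms occurring are fluted k-atoms p(x_ℓ,…,x_k) for various k;
  -- distinct pairs (k , atom) are distinct atoms, so (no equality in σ)
  -- consistency is satisfiability under a valuation of all such atoms.

  Val : Set
  Val = (k : ℕ) → Atom k → Bool

  _⊩a_ : {k : ℕ} → Val → Atom k → Set
  _⊩a_ {k} V a = V k a ≡ true

  _⊩l_ : {k : ℕ} → Val → Lit k → Set
  _⊩l_ {k} V (b , a) = V k a ≡ b

  _⊩c_ : {k : ℕ} → Val → Clause k → Set
  V ⊩c c = Any (λ l → V ⊩l l) c

  _⊩cs_ : {k : ℕ} → Val → List (Clause k) → Set
  V ⊩cs cs = All (λ c → V ⊩c c) cs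

  LitSet : ℕ → Set₁
  LitSet k = Lit k → Set

  _⊩s_ : {k : ℕ} → Val → LitSet k → Set
  V ⊩s S = ∀ l → S l → V ⊩l l

  ConsistentSet : {k : ℕ} → LitSet k → Set
  ConsistentSet S = Σ Val λ V → V ⊩s S

  insert : {k : ℕ} → Lit k → LitSet k → LitSet k
  insert l S l' = S l' ⊎ l' ≡ l

  IsType : {k : ℕ} → LitSet k → Set
  IsType S = ConsistentSet S × (∀ l → ¬ S l → ¬ ConsistentSet (insert l S))

  FlType : ℕ → Set₁
  FlType k = Σ (LitSet k) IsType

  -- τ^[1]: increment all variable indices (a k-literal set becomes a
  -- (k+1)-literal set; p(x_ℓ..x_k) ↦ p(x_{ℓ+1}..x_{k+1}))
  _^[1] : {k : ℕ} → LitSet k → LitSet (suc k)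
  _^[1] {k} S (b , (p , _)) = Σ (ar σ p ≤ k) λ h → S (b , (p , h))

  -- τ_↑: remove literals containing x_1 and decrement indices
  _↑ : {k : ℕ} → LitSet (suc k) → LitSet k
  _↑ S (b , (p , h)) = S (b , (p , m≤n⇒m≤1+n h))

  _≐_ : {k : ℕ} → LitSet k → LitSet k → Set
  S ≐ S' = ∀ l → (S l → S' l) × (S' l → S l)

  record Connector : Set₁ where
    field
      π    : FlType 1
      I    : FlType 2 → Set
      O    : FlType 2 → Set
      I-ok : ∀ τ → I τ → (proj₁ τ ↑) ≐ proj₁ π
  open Connector public

  module _ {s t : ℕ} (φ : NF s t) where
    open NF φ

    Cons : LitSet 2 → LitSet 2 → List (Clause 3) → Set
    Cons τ τ' Γ' = Σ Val λ V →
        V ⊩s τ × V ⊩s (τ' ^[1]) × V ⊩cs Γ' × V ⊩cs Ω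
      × (∀ j → V ⊩a β j → V ⊩c δ j)

    Entails : LitSet 2 → Atom 2 → Set
    Entails τ a = ∀ V → V ⊩s τ → V ⊩a a

    LocallyCompatible : Connector → Set₁
    LocallyCompatible c =
        (∀ i (τ : FlType 2) → I c τ → Entails (proj₁ τ) (α i)
           → Σ (FlType 2) λ τ' → O c τ' × Cons (proj₁ τ) (proj₁ τ') (Γ i))
      × (∀ (τ τ' : FlType 2) → I c τ → O c τ'
           → Cons (proj₁ τ) (proj₁ τ') [])

  GloballyCoherent : List Connector → Set₁
  GloballyCoherent C =
      (∀ c → c ∈ C → ∀ τ → O c τ → Any (λ c' → I c' τ) C)
    × (∀ c c' → c ∈ C → c' ∈ C → Σ (FlType 2) λ τ → O c τ × I c' τ)

  ConditionII : {s t : ℕ} → NF s t → Set₁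
  ConditionII φ = Σ (List Connector) λ C →
      1 ≤ length C × length C ≤ 2 ^ m σ
    × GloballyCoherent C × All (LocallyCompatible φ) C

-- 2-types are coded by bit vectors of length |σ|. From a model we saturate: pairs (x, y)
-- with pairwise distinct codes represent connector-types, and a pair is added whenever a
-- code leaving a representative (towards another representative, or towards the
-- α_i-witness the model provides) is not represented yet; distinctness stops this after at
-- most 2^|σ| rounds. The coded connector-types give (ii) directly, and also a model on
-- connector × {1,…,s} of size ≤ s·2^|σ|: the copy (k, i) is the α_i-witness of every pair
-- whose code is routed to k, and LC∀ takes care of all other triples. Conversely, (ii)
-- yields a tree model whose nodes are witnesses created on demand: a node is joined to its
-- parent by the out-type that LC∃ provides, GC∃ supplies its connector-type, GC∀ joins
-- all other pairs, and LC∀ makes every triple consistent.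
module Submission where

open import Defs
open import Axiom.UniquenessOfIdentityProofs using (module Decidable⇒UIP)
open import Data.Bool using (Bool; true; false)
import Data.Bool as Bool
open import Data.Empty using (⊥-elim)
open import Data.Fin using (Fin; zero; suc; fromℕ<; combine; remQuot; funToFin; finToFun)
import Data.Fin.Properties as Fin
open import Data.Fin.Subset.Properties using (anySubset?)
open import Data.List using (List; []; _∷_; length; tabulate)
import Data.List as List
open import Data.List.Properties using (length-tabulate)
open import Data.List.Membership.Propositional using (_∈_)
open import Data.List.Membership.Propositional.Properties using (∈-lookup)
open import Data.List.Relation.Unary.All using (All)
import Data.List.Relation.Unary.All as All
import Data.List.Relation.Unary.All.Properties as All
open import Data.List.Relation.Unary.Any using (Any; here; there)
import Data.List.Relation.Unary.Any as Any
import Data.List.Relation.Unary.Any.Properties as Any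
open import Data.Nat using (ℕ; zero; suc; _≤_; _<_; _+_; _*_; _^_; z≤n; s≤s; _≤?_; _≟_)
open import Data.Nat.Properties
  using (≤-irrelevant; m≤n⇒m≤1+n; ≤-refl; ≤-trans; ≤-reflexive; <-irrefl;
         +-identityʳ; +-suc; ≤⇒≯; *-comm; *-mono-≤; *-monoˡ-≤; *-monoʳ-≤; ^-monoʳ-≤; m≤m+n)
open import Data.Product using (Σ; _×_; _,_; proj₁; proj₂)
open import Data.Sum using (_⊎_; inj₁; inj₂)
open import Data.Vec using (Vec; []; _∷_; lookup)
import Data.Vec as Vec
open import Data.Vec.Properties using (lookup∘tabulate; tabulate∘lookup; tabulate-cong; ≡-dec)
import Data.Vec.Functional as Vector
open import Function using (_∘_; Inverse)
open import Function.Definitions using (Injective)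
open import Relation.Binary.Definitions using (DecidableEquality)
open import Relation.Binary.PropositionalEquality
  using (_≡_; refl; sym; trans; cong; subst; module ≡-Reasoning)
open ≡-Reasoning
open import Relation.Nullary using (¬_; Dec; yes; no)
open import Relation.Nullary.Decidable using (_×-dec_; _⊎-dec_; ¬?; decidable-stable)

injective⇒≤2^ : ∀ {n K} (f : Fin K → Vec Bool n) → Injective _≡_ _≡_ f → K ≤ 2 ^ n
injective⇒≤2^ {n} f f-injective = Fin.injective⇒≤ {f = encode ∘ f} (f-injective ∘ encode-injective)
  where
    open Inverse Fin.2↔Bool using (to; from; strictlyInverseˡ)

    encode : Vec Bool n → Fin (2 ^ n)
    encode v = funToFin (from ∘ lookup v)

    encode-injective : Injective _≡_ _≡_ encode
    encode-injective {v} {w} eq = begin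
      v                       ≡⟨ tabulate∘lookup v ⟨
      Vec.tabulate (lookup v) ≡⟨ tabulate-cong same-bit ⟩
      Vec.tabulate (lookup w) ≡⟨ tabulate∘lookup w ⟩
      w                       ∎
      where
        same-bit : ∀ i → lookup v i ≡ lookup w i
        same-bit i = begin
          lookup v i                 ≡⟨ strictlyInverseˡ _ ⟨
          to (from (lookup v i))     ≡⟨ cong to (Fin.finToFun-funToFin _ i) ⟨
          to (finToFun (encode v) i) ≡⟨ cong (λ k → to (finToFun k i)) eq ⟩
          to (finToFun (encode w) i) ≡⟨ cong to (Fin.finToFun-funToFin _ i) ⟩
          to (from (lookup w i))     ≡⟨ strictlyInverseˡ _ ⟩
          lookup w i                 ∎

module _ (σ : Sig) where

  private
    variable
      k : ℕ
      D : Set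

    infix 4 _⊩ˡ_ _⊩ᵃ_ _⊩ᶜ_ _⊩ᶜˢ_ _⊩ˢ_

    _⊩ˡ_ : Val σ → Lit σ k → Set
    _⊩ˡ_ = _⊩l_ σ

    _⊩ᵃ_ : Val σ → Atom σ k → Set
    _⊩ᵃ_ = _⊩a_ σ

    _⊩ᶜ_ : Val σ → Clause σ k → Set
    _⊩ᶜ_ = _⊩c_ σ

    _⊩ᶜˢ_ : Val σ → List (Clause σ k) → Set
    _⊩ᶜˢ_ = _⊩cs_ σ

    _⊩ˢ_ : Val σ → LitSet σ k → Set
    _⊩ˢ_ = _⊩s_ σ

  val-irrelevant : (V : Val σ) (p : Fin (m σ)) (h h′ : ar σ p ≤ k) → V k (p , h) ≡ V k (p , h′)
  val-irrelevant V p h h′ = cong (λ h″ → V _ (p , h″)) (≤-irrelevant h h′)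

  lastN-∷ : ∀ {a} (h : a ≤ suc k) (h′ : a ≤ k) (x : D) (xs : Vec D k) →
            lastN σ h (x ∷ xs) ≡ lastN σ h′ xs
  lastN-∷ {k} {a = a} h h′ x xs with a ≟ suc k
  ... | yes refl = ⊥-elim (<-irrefl refl h′)
  ... | no _     = cong (λ h″ → lastN σ h″ xs) (≤-irrelevant _ _)

  -- V on the k-atom of p, and the junk value false when ar p > k
  valAt : Val σ → (k : ℕ) → Fin (m σ) → Bool
  valAt V k p with ar σ p ≤? k
  ... | yes h = V k (p , h)
  ... | no _  = false

  valAt-≤ : (V : Val σ) (p : Fin (m σ)) (h : ar σ p ≤ k) → valAt V k p ≡ V k (p , h)
  valAt-≤ {k} V p h with ar σ p ≤? k
  ... | yes h′ = val-irrelevant V p h′ h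
  ... | no h≰ = ⊥-elim (h≰ h)

  valAt-≰ : (V : Val σ) (p : Fin (m σ)) → ¬ ar σ p ≤ k → valAt V k p ≡ false
  valAt-≰ {k} V p h≰ with ar σ p ≤? k
  ... | yes h = ⊥-elim (h≰ h)
  ... | no _  = refl

  typeVal : FlType σ k → Val σ
  typeVal (_ , (V , _) , _) = V

  typeVal-⊩ : (τ : FlType σ k) → typeVal τ ⊩ˢ proj₁ τ
  typeVal-⊩ (_ , (_ , V⊩τ) , _) = V⊩τ

  -- By maximality: were W to differ from typeVal τ at a, the literal that typeVal τ assigns
  -- to a would be missing from τ although it can be added consistently.
  ⊩type⇒typeVal : (τ : FlType σ k) (W : Val σ) → W ⊩ˢ proj₁ τ → ∀ a → W k a ≡ typeVal τ k a
  ⊩type⇒typeVal {k} (S , (V , V⊩S) , maximal) W W⊩S a with W k a Bool.≟ V k a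
  ... | yes eq  = eq
  ... | no  neq = ⊥-elim (maximal (V k a , a) (λ Sa → neq (W⊩S _ Sa)) (V , V⊩S+a))
    where
      V⊩S+a : V ⊩ˢ insert σ (V k a , a) S
      V⊩S+a l (inj₁ Sl)   = V⊩S l Sl
      V⊩S+a _ (inj₂ refl) = refl

  -- Maximality alone only yields ¬ ¬ proj₁ τ l here.
  Saturated : FlType σ k → Set
  Saturated τ = ∀ l → typeVal τ ⊩ˡ l → proj₁ τ l

  shiftVal : Val σ → Val σ
  shiftVal V k (p , h) = V (suc k) (p , m≤n⇒m≤1+n h)

  ⊩^[1]⇒shiftVal⊩ : (V : Val σ) (S : LitSet σ k) → V ⊩ˢ _^[1] σ S → shiftVal V ⊩ˢ S
  ⊩^[1]⇒shiftVal⊩ V S V⊩S⁺ (b , (p , h)) Sl = V⊩S⁺ (b , (p , m≤n⇒m≤1+n h)) (h , Sl)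

  -- A fluted 2-type is fixed by the values of p(x₁,x₂) for ar p = 2 and of p(x₂) for ar p = 1.
  -- A code records them with one bit per predicate; bits of predicates of arity > 2 are junk.
  Code : Set
  Code = Vec Bool (m σ)

  Canonical : Code → Set
  Canonical c = ∀ p → ¬ ar σ p ≤ 2 → lookup c p ≡ false

  HasCode₁₂ : Val σ → Code → Set
  HasCode₁₂ V c = ∀ p (h : ar σ p ≤ 2) → V 2 (p , h) ≡ lookup c p

  -- the 3-atoms of predicates of arity ≤ 2 are those in the variables x₂, x₃
  HasCode₂₃ : Val σ → Code → Set
  HasCode₂₃ V c = ∀ p (h : ar σ p ≤ 2) (h′ : ar σ p ≤ 3) → V 3 (p , h′) ≡ lookup c p

  codeOf : Val σ → Code
  codeOf V = Vec.tabulate (valAt V 2)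

  codeOf-hasCode₁₂ : ∀ V → HasCode₁₂ V (codeOf V)
  codeOf-hasCode₁₂ V p h = sym (trans (lookup∘tabulate _ p) (valAt-≤ V p h))

  codeOf-canonical : ∀ V → Canonical (codeOf V)
  codeOf-canonical V p h≰ = trans (lookup∘tabulate _ p) (valAt-≰ V p h≰)

  codeVal : Code → Val σ
  codeVal c _ (p , _) = lookup c p

  codeType : (k : ℕ) → Code → FlType σ k
  codeType k c = (codeVal c ⊩ˡ_) , (codeVal c , λ _ V⊩l → V⊩l) , maximal
    where
      maximal : ∀ l → ¬ codeVal c ⊩ˡ l → ¬ ConsistentSet σ (insert σ l (codeVal c ⊩ˡ_))
      maximal (b , (p , h)) ¬c⊩l (W , W⊩) =
        ¬c⊩l (trans (sym (W⊩ (lookup c p , (p , h)) (inj₁ refl))) (W⊩ (b , (p , h)) (inj₂ refl)))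

  codeType-saturated : ∀ c → Saturated (codeType k c)
  codeType-saturated c _ c⊩l = c⊩l

  typeCode : FlType σ 2 → Code
  typeCode τ = codeOf (typeVal τ)

  typeCode-codeType : ∀ c → Canonical c → typeCode (codeType 2 c) ≡ c
  typeCode-codeType c c-canonical = trans (tabulate-cong same-bit) (tabulate∘lookup c)
    where
      same-bit : ∀ p → valAt (codeVal c) 2 p ≡ lookup c p
      same-bit p with ar σ p ≤? 2
      ... | yes _ = refl
      ... | no h≰ = sym (c-canonical p h≰)

  ⊩type⇒hasCode₁₂ : (τ : FlType σ 2) (V : Val σ) → V ⊩ˢ proj₁ τ → HasCode₁₂ V (typeCode τ)
  ⊩type⇒hasCode₁₂ τ V V⊩τ p h =
    trans (⊩type⇒typeVal τ V V⊩τ (p , h)) (codeOf-hasCode₁₂ (typeVal τ) p h)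

  ⊩type^[1]⇒hasCode₂₃ : (τ : FlType σ 2) (V : Val σ) → V ⊩ˢ _^[1] σ (proj₁ τ) → HasCode₂₃ V (typeCode τ)
  ⊩type^[1]⇒hasCode₂₃ τ V V⊩τ⁺ p h h′ =
    trans (val-irrelevant V p h′ (m≤n⇒m≤1+n h))
          (⊩type⇒hasCode₁₂ τ (shiftVal V) (⊩^[1]⇒shiftVal⊩ V (proj₁ τ) V⊩τ⁺) p h)

  hasCode₁₂⇒⊩type : (τ : FlType σ 2) (V : Val σ) → HasCode₁₂ V (typeCode τ) → V ⊩ˢ proj₁ τ
  hasCode₁₂⇒⊩type τ V V∼τ (b , (p , h)) τl =
    trans (trans (V∼τ p h) (sym (codeOf-hasCode₁₂ (typeVal τ) p h))) (typeVal-⊩ τ _ τl)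

  hasCode₂₃⇒⊩type^[1] : (τ : FlType σ 2) (V : Val σ) → HasCode₂₃ V (typeCode τ) → V ⊩ˢ _^[1] σ (proj₁ τ)
  hasCode₂₃⇒⊩type^[1] τ V V∼τ (b , (p , h′)) (h , τl) =
    trans (trans (V∼τ p h h′) (sym (codeOf-hasCode₁₂ (typeVal τ) p h))) (typeVal-⊩ τ _ τl)

  I-unary : (c : Connector σ) (τ : FlType σ 2) → I c τ →
            ∀ p (h : ar σ p ≤ 1) → lookup (typeCode τ) p ≡ typeVal (π c) 1 (p , h)
  I-unary c τ τ∈I p h =
    trans (sym (codeOf-hasCode₁₂ (typeVal τ) p (m≤n⇒m≤1+n h)))
          (⊩type⇒typeVal (π c) (shiftVal (typeVal τ)) ⊩π (p , h))
    where
      ⊩π : shiftVal (typeVal τ) ⊩ˢ proj₁ (π c)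
      ⊩π l πl = typeVal-⊩ τ _ (proj₂ (I-ok c τ τ∈I l) πl)

  record Agrees (M : Structure σ D) (V : Val σ) (xs : Vec D k) : Set where
    constructor agrees
    field agree : ∀ p (h : ar σ p ≤ k) → V k (p , h) ≡ M p (lastN σ h xs)

  module _ {M : Structure σ D} {V : Val σ} {xs : Vec D k} (V∼M : Agrees M V xs) where
    open Agrees V∼M

    agrees⇒⊩atom : ∀ a → holdsAtom σ M a xs → V ⊩ᵃ a
    agrees⇒⊩atom (p , h) = trans (agree p h)

    agrees⇒holdsClause : ∀ c → V ⊩ᶜ c → holdsClause σ M c xs
    agrees⇒holdsClause _ = Any.map λ { {b , (p , h)} → trans (sym (agree p h)) }

    agrees⇒holdsClauses : ∀ cs → V ⊩ᶜˢ cs → holdsClauses σ M cs xs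
    agrees⇒holdsClauses _ = All.map (agrees⇒holdsClause _)

  module _ {s t : ℕ} (φ : NF σ s t) where
    open NF φ

    record CodeCons (c c′ : Code) (Θ : List (Clause σ 3)) : Set where
      field
        val    : Val σ
        code₁₂ : HasCode₁₂ val c
        code₂₃ : HasCode₂₃ val c′
        ⊩Θ     : val ⊩ᶜˢ Θ
        ⊩Ω     : val ⊩ᶜˢ Ω
        ⊩β→δ   : ∀ j → val ⊩ᵃ β j → val ⊩ᶜ δ j
    open CodeCons public

    forgetΘ : ∀ {c c′ Θ} → CodeCons c c′ Θ → CodeCons c c′ []
    forgetΘ w = record { val = val w ; code₁₂ = code₁₂ w ; code₂₃ = code₂₃ w
                       ; ⊩Θ = All.[] ; ⊩Ω = ⊩Ω w ; ⊩β→δ = ⊩β→δ w }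

    cons⇒codeCons : ∀ (τ τ′ : FlType σ 2) {Θ} → Cons σ φ (proj₁ τ) (proj₁ τ′) Θ →
                    CodeCons (typeCode τ) (typeCode τ′) Θ
    cons⇒codeCons τ τ′ (V , V⊩τ , V⊩τ′ , V⊩Θ , V⊩Ω , V⊩β→δ) = record
      { val = V ; code₁₂ = ⊩type⇒hasCode₁₂ τ V V⊩τ ; code₂₃ = ⊩type^[1]⇒hasCode₂₃ τ′ V V⊩τ′
      ; ⊩Θ = V⊩Θ ; ⊩Ω = V⊩Ω ; ⊩β→δ = V⊩β→δ }

    codeCons⇒cons : ∀ (τ τ′ : FlType σ 2) {Θ} → CodeCons (typeCode τ) (typeCode τ′) Θ →
                    Cons σ φ (proj₁ τ) (proj₁ τ′) Θ
    codeCons⇒cons τ τ′ w =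
      val w , hasCode₁₂⇒⊩type τ (val w) (code₁₂ w) , hasCode₂₃⇒⊩type^[1] τ′ (val w) (code₂₃ w)
            , ⊩Θ w , ⊩Ω w , ⊩β→δ w

    αSymbol : Fin s → Fin (m σ)
    αSymbol i = proj₁ (α i)

    αHolds : Code → Fin s → Set
    αHolds c i = lookup c (αSymbol i) ≡ true

    entails⇒αHolds : ∀ (τ : FlType σ 2) i → Entails σ φ (proj₁ τ) (α i) → αHolds (typeCode τ) i
    entails⇒αHolds τ i τ⇒α =
      trans (sym (codeOf-hasCode₁₂ (typeVal τ) _ (proj₂ (α i)))) (τ⇒α (typeVal τ) (typeVal-⊩ τ))

    αHolds⇒entails : ∀ (τ : FlType σ 2) i → αHolds (typeCode τ) i → Entails σ φ (proj₁ τ) (α i)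
    αHolds⇒entails τ i αbit V V⊩τ = trans (⊩type⇒hasCode₁₂ τ V V⊩τ _ (proj₂ (α i))) αbit

    record CodeFrame (E : Set) : Set where
      field
        pairCode       : E → E → Code
        pairCode-unary : ∀ x x′ y p → ar σ p ≤ 1 → lookup (pairCode x y) p ≡ lookup (pairCode x′ y) p
        triple         : ∀ x y z → CodeCons (pairCode x y) (pairCode y z) []
        witness        : ∀ x y i → αHolds (pairCode x y) i →
                         Σ E λ z → val (triple x y z) ⊩ᶜˢ Γ i

    module FrameModel {E : Set} (F : CodeFrame E) where
      open CodeFrame F

      table : Fin (m σ) → (n : ℕ) → Vec E n → Bool
      table p 1 (y ∷ [])         = lookup (pairCode y y) p
      table p 2 (x ∷ y ∷ [])     = lookup (pairCode x y) p
      table p 3 (x ∷ y ∷ z ∷ []) = valAt (val (triple x y z)) 3 p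
      table p _ _                = false

      structure : Structure σ E
      structure p = table p (ar σ p)

      table₂ : ∀ p {n} (h : n ≤ 2) x y → 1 ≤ n →
                 (n ≤ 1 × table p n (lastN σ h (x ∷ y ∷ [])) ≡ lookup (pairCode y y) p)
               ⊎ table p n (lastN σ h (x ∷ y ∷ [])) ≡ lookup (pairCode x y) p
      table₂ p {1} h x y _ = inj₁ (≤-refl , refl)
      table₂ p {2} h x y _ = inj₂ refl
      table₂ p {suc (suc (suc _))} (s≤s (s≤s ())) x y _

      table₃ : ∀ p {n} (h : n ≤ 3) x y z → 1 ≤ n →
                 (n ≤ 1 × table p n (lastN σ h (x ∷ y ∷ z ∷ [])) ≡ lookup (pairCode z z) p)
               ⊎ (n ≤ 2 × table p n (lastN σ h (x ∷ y ∷ z ∷ [])) ≡ lookup (pairCode y z) p)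
               ⊎ table p n (lastN σ h (x ∷ y ∷ z ∷ [])) ≡ valAt (val (triple x y z)) 3 p
      table₃ p {1} h x y z _ = inj₁ (≤-refl , refl)
      table₃ p {2} h x y z _ = inj₂ (inj₁ (≤-refl , refl))
      table₃ p {3} h x y z _ = inj₂ (inj₂ refl)
      table₃ p {suc (suc (suc (suc _)))} (s≤s (s≤s (s≤s ()))) x y z _

      agrees₂ : ∀ x y V → HasCode₁₂ V (pairCode x y) → Agrees structure V (x ∷ y ∷ [])
      agrees₂ x y V V∼xy = agrees agree₂
        where
          agree₂ : ∀ p (h : ar σ p ≤ 2) → V 2 (p , h) ≡ structure p (lastN σ h (x ∷ y ∷ []))
          agree₂ p h with table₂ p h x y (ar-pos σ p)
          ... | inj₁ (h₁ , eq) = trans (V∼xy p h) (trans (pairCode-unary x y y p h₁) (sym eq))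
          ... | inj₂ eq        = trans (V∼xy p h) (sym eq)

      agrees₃ : ∀ x y z → Agrees structure (val (triple x y z)) (x ∷ y ∷ z ∷ [])
      agrees₃ x y z = agrees agree₃
        where
          w : CodeCons (pairCode x y) (pairCode y z) []
          w = triple x y z
          agree₃ : ∀ p (h : ar σ p ≤ 3) → val w 3 (p , h) ≡ structure p (lastN σ h (x ∷ y ∷ z ∷ []))
          agree₃ p h with table₃ p h x y z (ar-pos σ p)
          ... | inj₁ (h₁ , eq)        = trans (code₂₃ w p (m≤n⇒m≤1+n h₁) h)
                                              (trans (pairCode-unary y z z p h₁) (sym eq))
          ... | inj₂ (inj₁ (h₂ , eq)) = trans (code₂₃ w p h₂ h) (sym eq)
          ... | inj₂ (inj₂ eq)        = trans (sym (valAt-≤ (val w) p h)) (sym eq)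

      α⇒αHolds : ∀ i x y → holdsAtom σ structure (α i) (x ∷ y ∷ []) → αHolds (pairCode x y) i
      α⇒αHolds i x y = agrees⇒⊩atom (agrees₂ x y (codeVal (pairCode x y)) (λ _ _ → refl)) (α i)

      model : _⊨_ σ φ structure
      model = (λ x y z → agrees⇒holdsClauses (agrees₃ x y z) Ω (⊩Ω (triple x y z)))
            , (λ i x y αxy → let (z , ⊩Γ) = witness x y i (α⇒αHolds i x y αxy)
                             in z , agrees⇒holdsClauses (agrees₃ x y z) (Γ i) ⊩Γ)
            , λ j x y βxy z → let w = triple x y z in
                agrees⇒holdsClause (agrees₃ x y z) (δ j)
                  (⊩β→δ w j (agrees⇒⊩atom (agrees₂ x y (val w) (code₁₂ w)) (β j) βxy))

    frame⇒model : ∀ {E} → CodeFrame E → Σ (Structure σ E) (_⊨_ σ φ)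
    frame⇒model F = FrameModel.structure F , FrameModel.model F

    reindexFrame : ∀ {E E′} (f : E′ → E) (g : E → E′) → (∀ x → f (g x) ≡ x) → CodeFrame E → CodeFrame E′
    reindexFrame f g f∘g F = record
      { pairCode       = λ x y → pairCode (f x) (f y)
      ; pairCode-unary = λ x x′ y → pairCode-unary (f x) (f x′) (f y)
      ; triple         = λ x y z → triple (f x) (f y) (f z)
      ; witness        = λ x y i αxy → let (z , ⊩Γ) = witness (f x) (f y) i αxy in
          g z , subst (λ z′ → val (triple (f x) (f y) z′) ⊩ᶜˢ Γ i) (sym (f∘g z)) ⊩Γ
      }
      where open CodeFrame F

    -- Connector-types with 2-types replaced by their codes, decidable in-sets, and a
    -- distinguished in-code per connector through which all out-codes are closed; the
    -- distinguished codes let a finite model decide deterministically where a pair is sent.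
    record CodedConnectors : Set₁ where
      field
        size          : ℕ
        nonempty      : 1 ≤ size
        size≤         : size ≤ 2 ^ m σ
        code          : Fin size → Code
        In Out        : Fin size → Code → Set
        In?           : ∀ j c → Dec (In j c)
        Out-canonical : ∀ j c → Out j c → Canonical c
        code∈In       : ∀ j → In j (code j)
        Out⇒code      : ∀ j c → Out j c → Σ (Fin size) λ j′ → code j′ ≡ c
        Out∩In        : ∀ j j′ → Σ Code λ c → Out j c × In j′ c
        In-unary      : ∀ j c c′ → In j c → In j c′ → ∀ p → ar σ p ≤ 1 → lookup c p ≡ lookup c′ p
        target        : Fin size → Code → Fin s → Code
        lc∃           : ∀ j c i → In j c → αHolds c i →
                        Out j (target j c i) × CodeCons c (target j c i) (Γ i)
        lc∀           : ∀ j c c′ → In j c → Out j c′ → CodeCons c c′ []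

    -- The copy (j , i) of connector j is reserved as witness for α_i.
    module FiniteFrame (C : CodedConnectors) where
      open CodedConnectors C

      Elem : Set
      Elem = Fin size × Fin s

      Leads : Fin size → Fin size → Fin s → Code → Set
      Leads j j′ i c = In j c × αHolds c i × target j c i ≡ code j′

      leads? : ∀ j j′ i c → Dec (Leads j j′ i c)
      leads? j j′ i c = In? j c ×-dec (lookup c (αSymbol i) Bool.≟ true)
                                ×-dec ≡-dec Bool._≟_ (target j c i) (code j′)

      -- If some in-code of j is sent towards code j′ by its α_i′-witness, the pair ends in
      -- (j′ , i′) with code j′, so that (j′ , i′) can serve as that witness.
      link : (x y : Elem) → Σ Code λ c → Out (proj₁ x) c × In (proj₁ y) c
      link (j , _) (j′ , i′) with anySubset? (leads? j j′ i′)
      ... | yes (c , c∈In , αc , c↦j′) =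
        code j′ , subst (Out j) c↦j′ (proj₁ (lc∃ j c i′ c∈In αc)) , code∈In j′
      ... | no _                        = Out∩In j j′

      pairCode : Elem → Elem → Code
      pairCode x y = proj₁ (link x y)

      pairCode-Out : ∀ x y → Out (proj₁ x) (pairCode x y)
      pairCode-Out x y = proj₁ (proj₂ (link x y))

      pairCode-In : ∀ x y → In (proj₁ y) (pairCode x y)
      pairCode-In x y = proj₂ (proj₂ (link x y))

      pairCode-leads : ∀ x j′ i′ c → Leads (proj₁ x) j′ i′ c → pairCode x (j′ , i′) ≡ code j′
      pairCode-leads (j , _) j′ i′ c leads with anySubset? (leads? j j′ i′)
      ... | yes _      = refl
      ... | no ¬leads = ⊥-elim (¬leads (c , leads))

      Continues : Elem → Elem → Elem → Set
      Continues x y (j″ , i″) = Leads (proj₁ y) j″ i″ (pairCode x y)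

      continues? : ∀ x y z → Dec (Continues x y z)
      continues? x y (j″ , i″) = leads? (proj₁ y) j″ i″ (pairCode x y)

      witnessCons : ∀ x y z → Continues x y z → CodeCons (pairCode x y) (pairCode y z) (Γ (proj₂ z))
      witnessCons x y (j″ , i″) leads@(c∈In , αc , c↦j″) =
        subst (λ c′ → CodeCons (pairCode x y) c′ (Γ i″))
              (trans c↦j″ (sym (pairCode-leads y j″ i″ (pairCode x y) leads)))
              (proj₂ (lc∃ (proj₁ y) (pairCode x y) i″ c∈In αc))

      triple : ∀ x y z → CodeCons (pairCode x y) (pairCode y z) []
      triple x y z with continues? x y z
      ... | yes cont = forgetΘ (witnessCons x y z cont)
      ... | no _     = lc∀ (proj₁ y) _ _ (pairCode-In x y) (pairCode-Out y z)

      triple-Γ : ∀ x y z → Continues x y z → val (triple x y z) ⊩ᶜˢ Γ (proj₂ z)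
      triple-Γ x y z cont with continues? x y z
      ... | yes cont′ = ⊩Θ (witnessCons x y z cont′)
      ... | no ¬cont  = ⊥-elim (¬cont cont)

      frame : CodeFrame Elem
      frame = record
        { pairCode       = pairCode
        ; pairCode-unary = λ x x′ y → In-unary (proj₁ y) _ _ (pairCode-In x y) (pairCode-In x′ y)
        ; triple         = triple
        ; witness        = witness
        }
        where
          witness : ∀ x y i → αHolds (pairCode x y) i → Σ Elem λ z → val (triple x y z) ⊩ᶜˢ Γ i
          witness x y i αxy
            with Out⇒code (proj₁ y) _ (proj₁ (lc∃ (proj₁ y) (pairCode x y) i (pairCode-In x y) αxy))
          ... | j″ , j″↦ = (j″ , i) , triple-Γ x y (j″ , i) (pairCode-In x y , αxy , sym j″↦)

    coded⇒satisfiableWithin : 1 ≤ s → CodedConnectors → SatisfiableWithin σ φ (s * 2 ^ (2 * m σ))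
    coded⇒satisfiableWithin s≥1 C =
      size * s , *-mono-≤ nonempty s≥1 , bound ,
      frame⇒model (reindexFrame (remQuot s) (λ (j , i) → combine j i)
                                (λ (j , i) → Fin.remQuot-combine j i) (FiniteFrame.frame C))
      where
        open CodedConnectors C
        bound : size * s ≤ s * 2 ^ (2 * m σ)
        bound = ≤-trans (*-monoˡ-≤ s size≤)
                 (≤-trans (≤-reflexive (*-comm (2 ^ m σ) s))
                          (*-monoʳ-≤ s (^-monoʳ-≤ 2 (m≤m+n (m σ) (m σ + 0)))))

    module CodedConnectorTypes (C : CodedConnectors) where
      open CodedConnectors C

      connector : Fin size → Connector σ
      connector j = record
        { π    = codeType 1 (code j)
        ; I    = λ τ → In j (typeCode τ) × Saturated τ
        ; O    = λ τ → Out j (typeCode τ) × Saturated τ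
        ; I-ok = λ τ (τ∈In , τ-sat) → restricts τ τ∈In τ-sat
        }
        where
          restricts : ∀ τ → In j (typeCode τ) → Saturated τ →
                      _≐_ σ (_↑ σ (proj₁ τ)) (proj₁ (codeType 1 (code j)))
          restricts τ τ∈In τ-sat (b , (p , h)) = (λ τl → trans (sym same) (typeVal-⊩ τ _ τl))
                                                , (λ πl → τ-sat _ (trans same πl))
            where
              same : typeVal τ 2 (p , m≤n⇒m≤1+n h) ≡ lookup (code j) p
              same = trans (codeOf-hasCode₁₂ (typeVal τ) p (m≤n⇒m≤1+n h))
                           (In-unary j _ _ τ∈In (code∈In j) p h)

      outType : ∀ j c → Out j c → Σ (FlType σ 2) λ τ → O (connector j) τ × typeCode τ ≡ c
      outType j c c∈Out = codeType 2 c , (subst (Out j) (sym c≡) c∈Out , codeType-saturated c) , c≡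
        where
          c≡ : typeCode (codeType 2 c) ≡ c
          c≡ = typeCode-codeType c (Out-canonical j c c∈Out)

      compatible : ∀ j → LocallyCompatible σ φ (connector j)
      compatible j = lc∃′ , lc∀′
        where
          lc∃′ : ∀ i (τ : FlType σ 2) → I (connector j) τ → Entails σ φ (proj₁ τ) (α i) →
                 Σ (FlType σ 2) λ τ′ → O (connector j) τ′ × Cons σ φ (proj₁ τ) (proj₁ τ′) (Γ i)
          lc∃′ i τ (τ∈In , _) τ⇒α with lc∃ j _ i τ∈In (entails⇒αHolds τ i τ⇒α)
          ... | c′∈Out , w with outType j _ c′∈Out
          ...   | τ′ , τ′∈O , τ′≡ =
            τ′ , τ′∈O , codeCons⇒cons τ τ′ (subst (λ c → CodeCons _ c _) (sym τ′≡) w)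

          lc∀′ : ∀ (τ τ′ : FlType σ 2) → I (connector j) τ → O (connector j) τ′ →
                 Cons σ φ (proj₁ τ) (proj₁ τ′) []
          lc∀′ τ τ′ (τ∈In , _) (τ′∈Out , _) = codeCons⇒cons τ τ′ (lc∀ j _ _ τ∈In τ′∈Out)

      connectors : List (Connector σ)
      connectors = tabulate connector

      ∈connectors : ∀ {c} → c ∈ connectors → Σ (Fin size) λ j → c ≡ connector j
      ∈connectors = Any.tabulate⁻

      coherent : GloballyCoherent σ connectors
      coherent = gc∃ , gc∀
        where
          gc∃ : ∀ c → c ∈ connectors → ∀ τ → O c τ → Any (λ c′ → I c′ τ) connectors
          gc∃ c c∈ τ τ∈O with ∈connectors c∈
          ... | j , refl with Out⇒code j _ (proj₁ τ∈O)
          ...   | j′ , j′≡ = Any.tabulate⁺ j′ (subst (In j′) j′≡ (code∈In j′) , proj₂ τ∈O)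

          gc∀ : ∀ c c′ → c ∈ connectors → c′ ∈ connectors → Σ (FlType σ 2) λ τ → O c τ × I c′ τ
          gc∀ c c′ c∈ c′∈ with ∈connectors c∈ | ∈connectors c′∈
          ... | j , refl | j′ , refl with Out∩In j j′
          ...   | w , w∈Out , w∈In with outType j w w∈Out
          ...     | τ , τ∈O , τ≡ = τ , τ∈O , subst (In j′) (sym τ≡) w∈In , proj₂ τ∈O

      conditionII : ConditionII σ φ
      conditionII = connectors
                  , subst (1 ≤_) (sym (length-tabulate connector)) nonempty
                  , subst (_≤ 2 ^ m σ) (sym (length-tabulate connector)) size≤
                  , coherent
                  , All.tabulate⁺ compatible

    module FromModel {D : Set} (M : Structure σ D) (M⊨φ : _⊨_ σ φ M) where

      ⊨∃ : ∀ i x y → holdsAtom σ M (α i) (x ∷ y ∷ []) → Σ D λ z → holdsClauses σ M (Γ i) (x ∷ y ∷ z ∷ [])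
      ⊨∃ = proj₁ (proj₂ M⊨φ)

      tripleVal : D → D → D → Val σ
      tripleVal x y z 2 (p , h) = M p (lastN σ h (x ∷ y ∷ []))
      tripleVal x y z 3 (p , h) = M p (lastN σ h (x ∷ y ∷ z ∷ []))
      tripleVal _ _ _ _ _       = false

      modelCode : D → D → Code
      modelCode x y = codeOf (tripleVal x y y)

      modelCode-unary : ∀ x x′ y p → ar σ p ≤ 1 → lookup (modelCode x y) p ≡ lookup (modelCode x′ y) p
      modelCode-unary x x′ y p h = begin
        lookup (modelCode x y) p             ≡⟨ sym (codeOf-hasCode₁₂ (tripleVal x y y) p h₂) ⟩
        M p (lastN σ h₂ (x ∷ y ∷ []))        ≡⟨ cong (M p) (lastN-∷ h₂ h x (y ∷ [])) ⟩
        M p (lastN σ h (y ∷ []))             ≡⟨ cong (M p) (sym (lastN-∷ h₂ h x′ (y ∷ []))) ⟩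
        M p (lastN σ h₂ (x′ ∷ y ∷ []))       ≡⟨ codeOf-hasCode₁₂ (tripleVal x′ y y) p h₂ ⟩
        lookup (modelCode x′ y) p            ∎
        where
          h₂ : ar σ p ≤ 2
          h₂ = m≤n⇒m≤1+n h

      -- M ⊨ Θ at (x, y, z) is literally tripleVal x y z ⊩ᶜˢ Θ, and likewise for Ω, β, δ.
      tripleCons : ∀ x y z {Θ} → holdsClauses σ M Θ (x ∷ y ∷ z ∷ []) →
                   CodeCons (modelCode x y) (modelCode y z) Θ
      tripleCons x y z M⊨Θ = record
        { val    = tripleVal x y z
        ; code₁₂ = codeOf-hasCode₁₂ (tripleVal x y y)
        ; code₂₃ = λ p h h′ → trans (cong (M p) (lastN-∷ h′ h x (y ∷ z ∷ [])))
                                    (codeOf-hasCode₁₂ (tripleVal y z z) p h)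
        ; ⊩Θ     = M⊨Θ
        ; ⊩Ω     = proj₁ M⊨φ x y z
        ; ⊩β→δ   = λ j βxy → proj₂ (proj₂ M⊨φ) j x y βxy z
        }

      witnessFor : ∀ x y i b → M (αSymbol i) (lastN σ (proj₂ (α i)) (x ∷ y ∷ [])) ≡ b → D
      witnessFor x y i true  αxy = proj₁ (⊨∃ i x y αxy)
      witnessFor x y i false _   = y

      witnessFor-Γ : ∀ x y i b (αxy≡b : M (αSymbol i) (lastN σ (proj₂ (α i)) (x ∷ y ∷ [])) ≡ b) →
                     holdsAtom σ M (α i) (x ∷ y ∷ []) →
                     holdsClauses σ M (Γ i) (x ∷ y ∷ witnessFor x y i b αxy≡b ∷ [])
      witnessFor-Γ x y i true  αxy _    = proj₂ (⊨∃ i x y αxy)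
      witnessFor-Γ x y i false ¬αxy αxy with () ← trans (sym ¬αxy) αxy

      -- junk value y when α_i(x, y) fails
      witness : D → D → Fin s → D
      witness x y i = witnessFor x y i _ refl

      witness-Γ : ∀ x y i → holdsAtom σ M (α i) (x ∷ y ∷ []) →
                  holdsClauses σ M (Γ i) (x ∷ y ∷ witness x y i ∷ [])
      witness-Γ x y i = witnessFor-Γ x y i _ refl

      -- The connector j is represented by the pair (src j , rep j).
      module Representatives {K : ℕ} (src rep : Fin K → D) where

        code : Fin K → Code
        code j = modelCode (src j) (rep j)

        In : Fin K → Code → Set
        In j c = Any (λ x → modelCode x (rep j) ≡ c) (src j ∷ tabulate rep)

        In? : ∀ j c → Dec (In j c)
        In? j c = Any.any? (λ x → ≡-dec Bool._≟_ (modelCode x (rep j)) c) _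

        source : Fin K → Code → D
        source j c with In? j c
        ... | yes c∈In = proj₁ (Any.satisfied c∈In)
        ... | no _     = src j

        source-code : ∀ j c → In j c → modelCode (source j c) (rep j) ≡ c
        source-code j c c∈In with In? j c
        ... | yes c∈In′ = proj₂ (Any.satisfied c∈In′)
        ... | no c∉In   = ⊥-elim (c∉In c∈In)

        target : Fin K → Code → Fin s → Code
        target j c i = modelCode (rep j) (witness (source j c) (rep j) i)

        Out : Fin K → Code → Set
        Out j c = (Σ (Fin K) λ j′ → modelCode (rep j) (rep j′) ≡ c)
                ⊎ (Σ Code λ c′ → Σ (Fin s) λ i → target j c′ i ≡ c)

        Out⇒realized : ∀ j c → Out j c → Σ D λ y → modelCode (rep j) y ≡ c
        Out⇒realized j c (inj₁ (j′ , eq))    = rep j′ , eq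
        Out⇒realized j c (inj₂ (c′ , i , eq)) = _ , eq

        Covered : Code → Set
        Covered c = Σ (Fin K) λ j → code j ≡ c

        covered? : ∀ c → Dec (Covered c)
        covered? c = Fin.any? λ j → ≡-dec Bool._≟_ (code j) c

        Uncovered : Set
        Uncovered = (Σ (Fin K) λ j → Σ (Fin K) λ j′ → ¬ Covered (modelCode (rep j) (rep j′)))
                  ⊎ (Σ (Fin K) λ j → Σ Code λ c → Σ (Fin s) λ i → ¬ Covered (target j c i))

        uncovered? : Dec Uncovered
        uncovered? = Fin.any? (λ j → Fin.any? λ j′ → ¬? (covered? _))
                     ⊎-dec Fin.any? (λ j → anySubset? λ c → Fin.any? λ i → ¬? (covered? _))

        uncoveredPair : Uncovered → Σ D λ x → Σ D λ y → ¬ Covered (modelCode x y)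
        uncoveredPair (inj₁ (j , j′ , ¬cov))    = rep j , rep j′ , ¬cov
        uncoveredPair (inj₂ (j , c , i , ¬cov)) = rep j , _ , ¬cov

        Out⇒covered : ¬ Uncovered → ∀ j c → Out j c → Covered c
        Out⇒covered ¬unc j c (inj₁ (j′ , refl)) =
          decidable-stable (covered? c) λ ¬cov → ¬unc (inj₁ (j , j′ , ¬cov))
        Out⇒covered ¬unc j c (inj₂ (c′ , i , refl)) =
          decidable-stable (covered? c) λ ¬cov → ¬unc (inj₂ (j , c′ , i , ¬cov))

        In-unary : ∀ j c c′ → In j c → In j c′ → ∀ p → ar σ p ≤ 1 → lookup c p ≡ lookup c′ p
        In-unary j c c′ c∈In c′∈In p h with Any.satisfied c∈In | Any.satisfied c′∈In
        ... | x , refl | x′ , refl = modelCode-unary x x′ (rep j) p h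

        lc∃ : ∀ j c i → In j c → αHolds c i → Out j (target j c i) × CodeCons c (target j c i) (Γ i)
        lc∃ j c i c∈In αc = inj₂ (c , i , refl)
                          , subst (λ c′ → CodeCons c′ (target j c i) (Γ i)) (source-code j c c∈In)
                                  (tripleCons x y _ (witness-Γ x y i αxy))
          where
            x y : D
            x = source j c
            y = rep j
            αxy : holdsAtom σ M (α i) (x ∷ y ∷ [])
            αxy = trans (codeOf-hasCode₁₂ (tripleVal x y y) _ (proj₂ (α i)))
                        (trans (cong (λ c′ → lookup c′ (αSymbol i)) (source-code j c c∈In)) αc)

        lc∀ : ∀ j c c′ → In j c → Out j c′ → CodeCons c c′ []
        lc∀ j c c′ c∈In c′∈Out with Any.satisfied c∈In | Out⇒realized j c′ c′∈Out
        ... | x , refl | y , refl = tripleCons x (rep j) y All.[]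

        coded : 1 ≤ K → Injective _≡_ _≡_ code → ¬ Uncovered → CodedConnectors
        coded K≥1 code-injective ¬unc = record
          { size          = K
          ; nonempty      = K≥1
          ; size≤         = injective⇒≤2^ code code-injective
          ; code          = code
          ; In            = In
          ; Out           = Out
          ; In?           = In?
          ; Out-canonical = λ j c c∈Out → subst Canonical (proj₂ (Out⇒realized j c c∈Out)) (codeOf-canonical _)
          ; code∈In       = λ j → here refl
          ; Out⇒code      = Out⇒covered ¬unc
          ; Out∩In        = λ j j′ → modelCode (rep j) (rep j′) , inj₁ (j′ , refl) , there (Any.tabulate⁺ j refl)
          ; In-unary      = In-unary
          ; target        = target
          ; lc∃           = lc∃
          ; lc∀           = lc∀
          }

      open Representatives

      extend-injective : ∀ {K} (src rep : Fin K → D) x y →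
                         Injective _≡_ _≡_ (code src rep) → ¬ Covered src rep (modelCode x y) →
                         Injective _≡_ _≡_ (code (x Vector.∷ src) (y Vector.∷ rep))
      extend-injective src rep x y inj ¬cov {zero}  {zero}  _  = refl
      extend-injective src rep x y inj ¬cov {zero}  {suc j} eq = ⊥-elim (¬cov (j , sym eq))
      extend-injective src rep x y inj ¬cov {suc i} {zero}  eq = ⊥-elim (¬cov (i , eq))
      extend-injective src rep x y inj ¬cov {suc i} {suc j} eq = cong suc (inj eq)

      -- Every round adds a pair with a new code, so fuel 2^|σ| suffices.
      saturate : ∀ fuel {K} (src rep : Fin K → D) → 1 ≤ K → Injective _≡_ _≡_ (code src rep) →
                 2 ^ m σ < K + fuel → CodedConnectors
      saturate zero {K} src rep _ code-injective bound =
        ⊥-elim (≤⇒≯ (subst (_≤ 2 ^ m σ) (sym (+-identityʳ K)) (injective⇒≤2^ _ code-injective)) bound)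
      saturate (suc fuel) {K} src rep K≥1 code-injective bound with uncovered? src rep
      ... | no ¬unc = coded src rep K≥1 code-injective ¬unc
      ... | yes unc with uncoveredPair src rep unc
      ...   | x , y , ¬cov = saturate fuel (x Vector.∷ src) (y Vector.∷ rep) (s≤s z≤n)
                               (extend-injective src rep x y code-injective ¬cov)
                               (subst (2 ^ m σ <_) (+-suc K fuel) bound)

    satisfiable⇒coded : Satisfiable σ φ → CodedConnectors
    satisfiable⇒coded (D , d , M , M⊨φ) =
      FromModel.saturate M M⊨φ (2 ^ m σ) {1} (λ _ → d) (λ _ → d) ≤-refl (λ { {zero} {zero} _ → refl }) ≤-refl

    module TreeModel (C : List (Connector σ)) (C≥1 : 1 ≤ length C)
                     (coherent : GloballyCoherent σ C) (compatible : All (LocallyCompatible σ φ) C) where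

      connector : Fin (length C) → Connector σ
      connector = List.lookup C

      compatibleAt : ∀ k → LocallyCompatible σ φ (connector k)
      compatibleAt k = All.lookup compatible (∈-lookup k)

      OutIn : Fin (length C) → Fin (length C) → Set₁
      OutIn k k′ = Σ (FlType σ 2) λ τ → O (connector k) τ × I (connector k′) τ

      type : ∀ {k k′} → OutIn k k′ → FlType σ 2
      type = proj₁

      defaultLink : ∀ k k′ → OutIn k k′
      defaultLink k k′ = proj₂ coherent _ _ (∈-lookup k) (∈-lookup k′)

      lc∀ : ∀ {k₀ k k′} (r : OutIn k₀ k) (r′ : OutIn k k′) →
            CodeCons (typeCode (type r)) (typeCode (type r′)) []
      lc∀ (τ , _ , τ∈I) (τ′ , τ′∈O , _) = cons⇒codeCons τ τ′ (proj₂ (compatibleAt _) τ τ′ τ∈I τ′∈O)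

      module _ {k₀ k} (r : OutIn k₀ k) (i : Fin s) (αr : αHolds (typeCode (type r)) i) where

        witnessType : Σ (FlType σ 2) λ τ′ → O (connector k) τ′ × Cons σ φ (proj₁ (type r)) (proj₁ τ′) (Γ i)
        witnessType = proj₁ (compatibleAt k) i (type r) (proj₂ (proj₂ r)) (αHolds⇒entails (type r) i αr)

        witnessKind∈ : Any (λ c → I c (proj₁ witnessType)) C
        witnessKind∈ = proj₁ coherent _ (∈-lookup k) _ (proj₁ (proj₂ witnessType))

        witnessKind : Fin (length C)
        witnessKind = Any.index witnessKind∈

        witnessLink : OutIn k witnessKind
        witnessLink = proj₁ witnessType , proj₁ (proj₂ witnessType) , Any.lookup-index witnessKind∈

        witnessCons : CodeCons (typeCode (type r)) (typeCode (type witnessLink)) (Γ i)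
        witnessCons = cons⇒codeCons (type r) (type witnessLink) (proj₂ (proj₂ witnessType))

      WitnessKind : ∀ {k₀ k} → OutIn k₀ k → Fin s → Fin (length C) → Set
      WitnessKind r i k′ = Σ (αHolds (typeCode (type r)) i) λ αr → k′ ≡ witnessKind r i αr

      witnessKind? : ∀ {k₀ k} (r : OutIn k₀ k) i k′ → Dec (WitnessKind r i k′)
      witnessKind? r i k′ with lookup (typeCode (type r)) (αSymbol i) Bool.≟ true
      ... | no ¬αr = no (¬αr ∘ proj₁)
      ... | yes αr with k′ Fin.≟ witnessKind r i αr
      ...   | yes k′≡ = yes (αr , k′≡)
      ...   | no k′≢  = no λ (αr′ , k′≡) → k′≢ (trans k′≡ (cong (witnessKind r i) (≡-irrelevant αr′ αr)))
        where open Decidable⇒UIP Bool._≟_ using (≡-irrelevant)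

      -- node x y i k is the α_i-witness of the pair (x, y), realizing the connector k
      data Tree : Set where
        root : Tree
        node : Tree → Tree → Fin s → Fin (length C) → Tree

      node-injective : ∀ {x y i k x′ y′ i′ k′} → node x y i k ≡ node x′ y′ i′ k′ →
                       x ≡ x′ × y ≡ y′ × i ≡ i′ × k ≡ k′
      node-injective refl = refl , refl , refl , refl

      _≟ᵀ_ : DecidableEquality Tree
      root ≟ᵀ root = yes refl
      root ≟ᵀ node _ _ _ _ = no λ ()
      node _ _ _ _ ≟ᵀ root = no λ ()
      node x y i k ≟ᵀ node x′ y′ i′ k′ with x ≟ᵀ x′ | y ≟ᵀ y′ | i Fin.≟ i′ | k Fin.≟ k′
      ... | yes refl | yes refl | yes refl | yes refl = yes refl
      ... | no x≢ | _ | _ | _ = no (x≢ ∘ proj₁ ∘ node-injective)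
      ... | _ | no y≢ | _ | _ = no (y≢ ∘ proj₁ ∘ proj₂ ∘ node-injective)
      ... | _ | _ | no i≢ | _ = no (i≢ ∘ proj₁ ∘ proj₂ ∘ proj₂ ∘ node-injective)
      ... | _ | _ | _ | no k≢ = no (k≢ ∘ proj₂ ∘ proj₂ ∘ proj₂ ∘ node-injective)

      kind : Tree → Fin (length C)
      kind root           = fromℕ< C≥1
      kind (node _ _ _ k) = k

      -- x is joined to its own α_i-witness by the LC∃ type, every other pair by a GC∀ type.
      linkToNode : ∀ x y {k₀} (r : OutIn k₀ (kind y)) i k → Dec (x ≡ y) → Dec (WitnessKind r i k) →
                   OutIn (kind x) k
      linkToNode x .x r i _ (yes refl) (yes (αr , refl)) = witnessLink r i αr
      linkToNode x y  r i k _          _                 = defaultLink (kind x) k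

      link : ∀ x y → OutIn (kind x) (kind y)
      link x root             = defaultLink (kind x) (kind root)
      link x (node x′ y i k) = linkToNode x y (link x′ y) i k (x ≟ᵀ y) (witnessKind? (link x′ y) i k)

      pairCode : Tree → Tree → Code
      pairCode x y = typeCode (type (link x y))

      -- The decisions are arguments so that they can be refined here in step with link.
      tripleToNode : ∀ x y x′ y′ i k (x≟ : Dec (x ≡ x′)) (y≟ : Dec (y ≡ y′))
                     (w? : Dec (WitnessKind (link x′ y′) i k)) →
                     CodeCons (pairCode x y) (typeCode (type (linkToNode y y′ (link x′ y′) i k y≟ w?))) []
      tripleToNode x y .x .y i _ (yes refl) (yes refl) (yes (αr , refl)) = forgetΘ (witnessCons (link x y) i αr)
      tripleToNode x y x′ y′ i k _ y≟ w? = lc∀ (link x y) (linkToNode y y′ (link x′ y′) i k y≟ w?)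

      tripleToNode-Γ : ∀ x y i k x≟ y≟ w? → WitnessKind (link x y) i k →
                       val (tripleToNode x y x y i k x≟ y≟ w?) ⊩ᶜˢ Γ i
      tripleToNode-Γ x y i _ (yes refl) (yes refl) (yes (αr , refl)) _ = ⊩Θ (witnessCons (link x y) i αr)
      tripleToNode-Γ x y i k (yes refl) (yes refl) (no ¬w) w = ⊥-elim (¬w w)
      tripleToNode-Γ x y i k (yes refl) (no y≢y) _ _         = ⊥-elim (y≢y refl)
      tripleToNode-Γ x y i k (no x≢x) _ _ _                  = ⊥-elim (x≢x refl)

      triple : ∀ x y z → CodeCons (pairCode x y) (pairCode y z) []
      triple x y root              = lc∀ (link x y) (link y root)
      triple x y (node x′ y′ i k) =
        tripleToNode x y x′ y′ i k (x ≟ᵀ x′) (y ≟ᵀ y′) (witnessKind? (link x′ y′) i k)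

      frame : CodeFrame Tree
      frame = record
        { pairCode       = pairCode
        ; pairCode-unary = λ x x′ y p h → trans (I-unary (connector (kind y)) _ (proj₂ (proj₂ (link x y))) p h)
                                               (sym (I-unary (connector (kind y)) _ (proj₂ (proj₂ (link x′ y))) p h))
        ; triple         = triple
        ; witness        = witness
        }
        where
          witness : ∀ x y i → αHolds (pairCode x y) i → Σ Tree λ z → val (triple x y z) ⊩ᶜˢ Γ i
          witness x y i αxy =
            node x y i (witnessKind (link x y) i αxy) ,
            tripleToNode-Γ x y i _ (x ≟ᵀ x) (y ≟ᵀ y) (witnessKind? (link x y) i _) (αxy , refl)

    conditionII⇒satisfiable : ConditionII σ φ → Satisfiable σ φ
    conditionII⇒satisfiable (C , C≥1 , _ , coherent , compatible) = Tree , root , frame⇒model frame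
      where open TreeModel C C≥1 coherent compatible

lemma5 : (σ : Sig) (s t : ℕ) (φ : NF σ s t) → 1 ≤ s →
    ((Satisfiable σ φ → ConditionII σ φ) × (ConditionII σ φ → Satisfiable σ φ))
    × ((Satisfiable σ φ → SatisfiableWithin σ φ (s * 2 ^ (2 * m σ)))
       × (SatisfiableWithin σ φ (s * 2 ^ (2 * m σ)) → Satisfiable σ φ))
lemma5 σ s t φ s≥1 =
    ( CodedConnectorTypes.conditionII σ φ ∘ satisfiable⇒coded σ φ
    , conditionII⇒satisfiable σ φ )
  , ( coded⇒satisfiableWithin σ φ s≥1 ∘ satisfiable⇒coded σ φ
    , λ (n , n≥1 , _ , M , M⊨φ) → Fin n , fromℕ< n≥1 , M , M⊨φ )
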